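{- Let $t$ be a weak-head normalising pure $\lambda$-term and let $\Phi_t$ be a principally typed derivation of $t$ in system $\mathcal{V}$. Then every leftmost typed reduction sequence starting at $\Phi_t$ is weak-head needed, i.e. each of its steps contracts a weak-head needed redex of the current term.
   Context: Pure $\lambda$-terms; occurrences words over $\{0,1\}$ ($0$: function part/abstraction body, $1$: argument); redex occurrences $p$ with $t|_p=(\lambda x.s)u$; standard residuals. Redex $r$ is to-the-left of $r'$ if $r$ is a proper prefix of $r'$ or $r=p0q$, $r'=p1q'$. WHNF: $\lambda x.t$ or $x\,t_1\cdots t_n$; $t$ weak-head normalising if $t\rightarrow_\beta^*$ some WHNF. A redex is weak-head needed in $t$ if every reduction sequence from $t$ to a WHNF contracts it or one of its residuals. System $\mathcal{V}$: types $\tau::=\mathtt{a}\mid\alpha\mid\mathcal{M}\to\tau$ ($\alpha$ type variables, $\mathcal{M}$ finite multisets); rules (ax) $x:[\tau]\vdash x:\tau$; (val) $\emptyset\vdash\lambda x.t:\mathtt{a}$; ($\to$i) from $\Gamma\vdash t:\tau$ infer $\Gamma\setminus x\vdash\lambda x.t:\Gamma(x)\to\tau$; ($\to$e) from $\Gamma\vdash t:[\sigma_i]_{i\in I}\to\tau$ and $(\Delta_i\vdash u:\sigma_i)_{i\in I}$ infer $\Gamma+\sum_i\Delta_i\vdash t\,u:\tau$. Typed occurrences $\mathrm{toc}(\Phi)$: $\{\epsilon\}$ for (ax),(val); $\{\epsilon\}\cup0\cdot\mathrm{toc}(\Phi_t)$ for ($\to$i); $\{\epsilon\}\cup0\cdot\mathrm{toc}(\Phi_t)\cup\bigcup_i1\cdot\mathrm{toc}(\Phi_u^i)$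 for ($\to$e). A derivation is normal if no redex occurrence of its subject is typed. Reduction of derivations: if $\Phi$ has subject $t$, $t\rightarrow_\beta t'$ contracting $r$, and $m$ is the longest prefix of $r$ in $\mathrm{toc}(\Phi)$, then $\Phi\rightarrow_\beta\Phi'$ where every subderivation at $m$ is rewritten: if $m=r$, the ($\to$e) with left premise ($\to$i) on $\lambda x.s$ (premise $\Phi_s$) and argument premises $(\Phi_u^i)$ is replaced by a typed substitution of $x$ by $(\Phi_u^i)$ in $\Phi_s$ (axioms on $x$ replaced by $\Phi_u^i$ of matching type, distributed nondeterministically; $u$ substituted for $x$ in untyped parts); otherwise only the subject is reduced. A typed reduction sequence contracts only typed redex occurrences; it is leftmost if each step contracts the leftmost (w.r.t. to-the-left) among the typed redex occurrences of the current derivation. Principally typed: a derivation of $\Gamma\vdash t:\tau$ with $t$ a WHNF is normal principally typed if either $t=x\,t_1\cdots t_n$, $\tau=\alpha$ a type variable and $\Gamma=\{x:[[\,]\to\cdots\to[\,]\to\alpha]\}$ ($n$ empty multisets), or $t=\lambda x.t'$, $\Gamma$ empty and $\tau=\mathtt{a}$. For weak-head normalising $t$, $\Phi_t$ is principally typed if whenever $\Phi_t\rightarrow_\beta^*\Phi_{t'}$ with $t'$ a WHNF reachable from $t$, $\Phi_{t'}$ is normal principally typed. -}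

module Defs where

open import Data.Nat using (ℕ; zero; suc; pred; _<_; _<ᵇ_; _≡ᵇ_)
open import Data.Bool using (if_then_else_)
open import Data.List using (List; []; _∷_; _++_; foldl; length)
open import Data.Maybe using (Maybe; just; nothing)
open import Data.Product using (Σ; ∃; ∃₂; _×_; _,_)
open import Data.Sum using (_⊎_)
open import Data.Unit using (⊤)
open import Relation.Binary.PropositionalEquality using (_≡_; _≢_)
open import Relation.Nullary using (¬_)
open import Data.List.Relation.Binary.Permutation.Propositional using (_↭_)
open import Data.List.Relation.Binary.Pointwise using (Pointwise)

-- Pure λ-terms (de Bruijn indices) and occurrences

data Term : Set where
  var : ℕ → Term
  lam : Term → Term
  app : Term → Term → Term

-- occurrence letters: d0 = function part / abstraction body, d1 = argument
data Dir : Set where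
  d0 d1 : Dir

Pos : Set
Pos = List Dir

_at_ : Term → Pos → Maybe Term
t at [] = just t
lam s at (d0 ∷ p) = s at p
app t u at (d0 ∷ p) = t at p
app t u at (d1 ∷ p) = u at p
_ at _ = nothing

Redex : Term → Pos → Set
Redex t p = ∃₂ λ s u → t at p ≡ just (app (lam s) u)

LeftOf : Pos → Pos → Set
LeftOf r r' =
  (Σ Pos λ w → w ≢ [] × r' ≡ r ++ w)
  ⊎ (Σ Pos λ p → Σ Pos λ q → Σ Pos λ q' → r ≡ p ++ (d0 ∷ q) × r' ≡ p ++ (d1 ∷ q'))

Prefix : Pos → Pos → Set
Prefix p q = Σ Pos λ w → q ≡ p ++ w

shiftVar : ℕ → ℕ → ℕ
shiftVar c x = if x <ᵇ c then x else suc x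

sh : ℕ → Term → Term
sh c (var x) = var (shiftVar c x)
sh c (lam t) = lam (sh (suc c) t)
sh c (app t u) = app (sh c t) (sh c u)

-- subst k u s : substitute u for the variable bound k binders up
-- (u already lives under those k binders); variables above k decremented
subst : ℕ → Term → Term → Term
subst k u (var x) = if x ≡ᵇ k then u else (if x <ᵇ k then var x else var (pred x))
subst k u (lam s) = lam (subst (suc k) (sh 0 u) s)
subst k u (app s s') = app (subst k u s) (subst k u s')

data Step : Term → Pos → Term → Set where
  β    : ∀ {s u} → Step (app (lam s) u) [] (subst 0 u s)
  lamS : ∀ {s p s'} → Step s p s' → Step (lam s) (d0 ∷ p) (lam s')
  appL : ∀ {t p t' u} → Step t p t' → Step (app t u) (d0 ∷ p) (app t' u)
  appR : ∀ {t u p u'} → Step u p u' → Step (app t u) (d1 ∷ p) (app t u')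

data Seq : Term → Term → Set where
  done : ∀ {t} → Seq t t
  cons : ∀ {t t₁ t₂} (p : Pos) → Step t p t₁ → Seq t₁ t₂ → Seq t t₂

data BoundOcc : ℕ → Term → Pos → Set where
  here : ∀ {k} → BoundOcc k (var k) []
  inLam : ∀ {k s v} → BoundOcc (suc k) s v → BoundOcc k (lam s) (d0 ∷ v)
  inFun : ∀ {k t u v} → BoundOcc k t v → BoundOcc k (app t u) (d0 ∷ v)
  inArg : ∀ {k t u v} → BoundOcc k u v → BoundOcc k (app t u) (d1 ∷ v)

-- Res t p q q' : q' is a residual of occurrence q after contracting the
-- redex at p in t (standard residuals)
data Res (t : Term) (p : Pos) : Pos → Pos → Set where
  resDisj : ∀ {q} → ¬ Prefix p q → Res t p q q
  resBody : ∀ {w} → Res t p (p ++ (d0 ∷ d0 ∷ w)) (p ++ w)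
  resArg  : ∀ {s u v w} → t at p ≡ just (app (lam s) u) → BoundOcc 0 s v →
            Res t p (p ++ (d1 ∷ w)) (p ++ (v ++ w))

data ContractsRes : ∀ {t t'} → Seq t t' → Pos → Set where
  now   : ∀ {t t₁ t₂ p} {st : Step t p t₁} {rest : Seq t₁ t₂} →
          ContractsRes (cons p st rest) p
  later : ∀ {t t₁ t₂ p q q'} {st : Step t p t₁} {rest : Seq t₁ t₂} →
          Res t p q q' → ContractsRes rest q' → ContractsRes (cons p st rest) q

data Neutral : Term → Set where
  nvar : ∀ {x} → Neutral (var x)
  napp : ∀ {t u} → Neutral t → Neutral (app t u)

data WHNF : Term → Set where
  wlam : ∀ {s} → WHNF (lam s)
  wneu : ∀ {t} → Neutral t → WHNF t

WHNormalising : Term → Set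
WHNormalising t = Σ Term λ t' → Seq t t' × WHNF t'

WeakHeadNeeded : Term → Pos → Set
WeakHeadNeeded t r = ∀ {t'} (σ : Seq t t') → WHNF t' → ContractsRes σ r

-- System V: types (multisets as lists, compared up to _≈M_)

infixr 5 _⇒_
data Type : Set where
  tA   : Type
  tvar : ℕ → Type
  _⇒_  : List Type → Type → Type

data _≈T_ : Type → Type → Set
data _≈M_ : List Type → List Type → Set

data _≈T_ where
  tA≈   : tA ≈T tA
  tvar≈ : ∀ {α} → tvar α ≈T tvar α
  ⇒≈    : ∀ {M M' τ τ'} → M ≈M M' → τ ≈T τ' → (M ⇒ τ) ≈T (M' ⇒ τ')

-- multiset equality: permutation up to type equality
data _≈M_ where
  []≈ : [] ≈M []
  ∷≈  : ∀ {σ σ' M N₁ N₂} → σ ≈T σ' → M ≈M (N₁ ++ N₂) → (σ ∷ M) ≈M (N₁ ++ (σ' ∷ N₂))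

Ctx : Set
Ctx = ℕ → List Type

∅ : Ctx
∅ _ = []

single : ℕ → List Type → Ctx
single x M y = if y ≡ᵇ x then M else []

_⊕_ : Ctx → Ctx → Ctx
(Γ ⊕ Δ) y = Γ y ++ Δ y

_≈C_ : Ctx → Ctx → Set
Γ ≈C Δ = ∀ y → Γ y ≈M Δ y

data Deriv : Ctx → Term → Type → Set
data Args : Ctx → Term → List Type → Set

data Deriv where
  ax   : ∀ {x τ} → Deriv (single x (τ ∷ [])) (var x) τ
  val  : ∀ {s} → Deriv ∅ (lam s) tA
  lamI : ∀ {Γ s τ} → Deriv Γ s τ → Deriv (λ y → Γ (suc y)) (lam s) (Γ 0 ⇒ τ)
  appE : ∀ {Γ Δ t u M N τ} → Deriv Γ t (M ⇒ τ) → Args Δ u N → M ≈M N →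
         Deriv (Γ ⊕ Δ) (app t u) τ

-- the family of argument derivations (Δ_i ⊢ u : σ_i)_{i ∈ I}, summed contexts
data Args where
  nil  : ∀ {u} → Args ∅ u []
  cons : ∀ {Δ₁ Δ₂ u σ N} → Deriv Δ₁ u σ → Args Δ₂ u N → Args (Δ₁ ⊕ Δ₂) u (σ ∷ N)

data TOcc : ∀ {Γ t τ} → Deriv Γ t τ → Pos → Set
data TOccArgs : ∀ {Δ u N} → Args Δ u N → Pos → Set

data TOcc where
  root  : ∀ {Γ t τ} {Φ : Deriv Γ t τ} → TOcc Φ []
  inLam : ∀ {Γ s τ p} {Φ : Deriv Γ s τ} → TOcc Φ p → TOcc (lamI Φ) (d0 ∷ p)
  inFun : ∀ {Γ Δ t u M N τ p} {Φ : Deriv Γ t (M ⇒ τ)} {as : Args Δ u N} {e : M ≈M N} →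
          TOcc Φ p → TOcc (appE Φ as e) (d0 ∷ p)
  inArg : ∀ {Γ Δ t u M N τ p} {Φ : Deriv Γ t (M ⇒ τ)} {as : Args Δ u N} {e : M ≈M N} →
          TOccArgs as p → TOcc (appE Φ as e) (d1 ∷ p)

data TOccArgs where
  hd : ∀ {Δ₁ Δ₂ u σ N p} {Φ : Deriv Δ₁ u σ} {as : Args Δ₂ u N} → TOcc Φ p → TOccArgs (cons Φ as) p
  tl : ∀ {Δ₁ Δ₂ u σ N p} {Φ : Deriv Δ₁ u σ} {as : Args Δ₂ u N} → TOccArgs as p → TOccArgs (cons Φ as) p

Normal : ∀ {Γ t τ} → Deriv Γ t τ → Set
Normal {t = t} Φ = ∀ p → Redex t p → ¬ TOcc Φ p

TypedRedex : ∀ {Γ t τ} → Deriv Γ t τ → Pos → Set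
TypedRedex {t = t} Φ p = Redex t p × TOcc Φ p

-- shifting derivations (weakening under a binder, cutoff c)

data Shifted : ℕ → ∀ {Γ t τ} → Deriv Γ t τ → ∀ {Γ' t' τ'} → Deriv Γ' t' τ' → Set
data ShiftedArgs : ℕ → ∀ {Δ u N} → Args Δ u N → ∀ {Δ' u' N'} → Args Δ' u' N' → Set

data Shifted where
  sAx  : ∀ {c x τ} → Shifted c (ax {x} {τ}) (ax {shiftVar c x} {τ})
  sVal : ∀ {c s} → Shifted c (val {s}) (val {sh (suc c) s})
  sLam : ∀ {c Γ s τ Γ' s' τ'} {Φ : Deriv Γ s τ} {Φ' : Deriv Γ' s' τ'} →
         Shifted (suc c) Φ Φ' → Shifted c (lamI Φ) (lamI Φ')
  sApp : ∀ {c Γ Δ t u M N τ Γ' Δ' t' u' M' N' τ'}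
           {Φ : Deriv Γ t (M ⇒ τ)} {as : Args Δ u N} {e : M ≈M N}
           {Φ' : Deriv Γ' t' (M' ⇒ τ')} {as' : Args Δ' u' N'} {e' : M' ≈M N'} →
         Shifted c Φ Φ' → ShiftedArgs c as as' → Shifted c (appE Φ as e) (appE Φ' as' e')

data ShiftedArgs where
  sNil  : ∀ {c u} → ShiftedArgs c (nil {u}) (nil {sh c u})
  sCons : ∀ {c Δ₁ Δ₂ u σ N Δ₁' Δ₂' u' σ' N'}
            {Φ : Deriv Δ₁ u σ} {as : Args Δ₂ u N} {Φ' : Deriv Δ₁' u' σ'} {as' : Args Δ₂' u' N'} →
          Shifted c Φ Φ' → ShiftedArgs c as as' → ShiftedArgs c (cons Φ as) (cons Φ' as')

BagItem : Term → Set
BagItem u = Σ Ctx λ Δ → Σ Type λ σ → Deriv Δ u σ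

argBag : ∀ {Δ u N} → Args Δ u N → List (BagItem u)
argBag nil = []
argBag (cons {Δ₁} {σ = σ} Φ as) = (Δ₁ , σ , Φ) ∷ argBag as

ShiftItem : ∀ {u} → BagItem u → BagItem (sh 0 u) → Set
ShiftItem (_ , _ , Φ) (_ , _ , Φ') = Shifted 0 Φ Φ'

-- TSub k u Φ B Φ' : Φ' results from Φ by substituting the variable bound
-- k binders up by u, each axiom on that variable being replaced by a
-- derivation of u from the bag B of matching type; B is used exactly once
-- (nondeterministic distribution).
data TSub : ℕ → (u : Term) → ∀ {Γ s τ} → Deriv Γ s τ → List (BagItem u) →
            ∀ {Γ' s' τ'} → Deriv Γ' s' τ' → Set
data TSubArgs : ℕ → (u : Term) → ∀ {Δ v N} → Args Δ v N → List (BagItem u) →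
                ∀ {Δ' v' N'} → Args Δ' v' N' → Set

data TSub where
  tHit   : ∀ {k u τ Δ σ} {Φu : Deriv Δ u σ} → σ ≈T τ →
           TSub k u (ax {k} {τ}) ((Δ , σ , Φu) ∷ []) Φu
  tBelow : ∀ {k u x τ} → x < k → TSub k u (ax {x} {τ}) [] (ax {x} {τ})
  tAbove : ∀ {k u x τ} → k < x → TSub k u (ax {x} {τ}) [] (ax {pred x} {τ})
  tVal   : ∀ {k u s} → TSub k u (val {s}) [] (val {subst (suc k) (sh 0 u) s})
  tLam   : ∀ {k u Γ s τ Γ' s' τ' B B'} {Φ : Deriv Γ s τ} {Φ' : Deriv Γ' s' τ'} →
           Pointwise ShiftItem B B' → TSub (suc k) (sh 0 u) Φ B' Φ' →
           TSub k u (lamI Φ) B (lamI Φ')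
  tApp   : ∀ {k u Γ Δ t v M N τ Γ' Δ' t' v' M' N' τ' B B₁ B₂}
             {Φ : Deriv Γ t (M ⇒ τ)} {as : Args Δ v N} {e : M ≈M N}
             {Φ' : Deriv Γ' t' (M' ⇒ τ')} {as' : Args Δ' v' N'} {e' : M' ≈M N'} →
           B ↭ (B₁ ++ B₂) → TSub k u Φ B₁ Φ' → TSubArgs k u as B₂ as' →
           TSub k u (appE Φ as e) B (appE Φ' as' e')

data TSubArgs where
  tNil  : ∀ {k u v} → TSubArgs k u (nil {v}) [] (nil {subst k u v})
  tCons : ∀ {k u Δ₁ Δ₂ v σ N Δ₁' Δ₂' v' σ' N' B B₁ B₂}
            {Φ : Deriv Δ₁ v σ} {as : Args Δ₂ v N} {Φ' : Deriv Δ₁' v' σ'} {as' : Args Δ₂' v' N'} →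
          B ↭ (B₁ ++ B₂) → TSub k u Φ B₁ Φ' → TSubArgs k u as B₂ as' →
          TSubArgs k u (cons Φ as) B (cons Φ' as')

-- reduction of derivations: DStep Φ r Φ' (subderivations at the longest
-- typed prefix m of r are rewritten; if m = r the typed redex is
-- replaced by a typed substitution, otherwise only the subject changes)

data DStep : ∀ {Γ t τ} → Deriv Γ t τ → Pos → ∀ {Γ' t' τ'} → Deriv Γ' t' τ' → Set
data DStepArgs : ∀ {Δ u N} → Args Δ u N → Pos → ∀ {Δ' u' N'} → Args Δ' u' N' → Set

data DStep where
  dβ   : ∀ {Γ s N τ Δ u Γ' s' τ'} {Φs : Deriv Γ s τ} {as : Args Δ u N}
           {e : Γ 0 ≈M N} {Φ' : Deriv Γ' s' τ'} →
         TSub 0 u Φs (argBag as) Φ' → DStep (appE (lamI Φs) as e) [] Φ'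
  dVal : ∀ {s r s'} → Step s r s' → DStep (val {s}) (d0 ∷ r) (val {s'})
  dLam : ∀ {Γ s τ Γ' s' τ' r} {Φ : Deriv Γ s τ} {Φ' : Deriv Γ' s' τ'} →
         DStep Φ r Φ' → DStep (lamI Φ) (d0 ∷ r) (lamI Φ')
  dFun : ∀ {Γ Δ t u M N τ Γ' t' M' τ' r}
           {Φ : Deriv Γ t (M ⇒ τ)} {as : Args Δ u N} {e : M ≈M N}
           {Φ' : Deriv Γ' t' (M' ⇒ τ')} {e' : M' ≈M N} →
         DStep Φ r Φ' → DStep (appE Φ as e) (d0 ∷ r) (appE Φ' as e')
  dArg : ∀ {Γ Δ t u M N τ Δ' u' N' r}
           {Φ : Deriv Γ t (M ⇒ τ)} {as : Args Δ u N} {e : M ≈M N}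
           {as' : Args Δ' u' N'} {e' : M ≈M N'} →
         DStepArgs as r as' → DStep (appE Φ as e) (d1 ∷ r) (appE Φ as' e')

data DStepArgs where
  dNil  : ∀ {u r u'} → Step u r u' → DStepArgs (nil {u}) r (nil {u'})
  dCons : ∀ {Δ₁ Δ₂ u σ N Δ₁' Δ₂' u' σ' N' r}
            {Φ : Deriv Δ₁ u σ} {as : Args Δ₂ u N} {Φ' : Deriv Δ₁' u' σ'} {as' : Args Δ₂' u' N'} →
          DStep Φ r Φ' → DStepArgs as r as' → DStepArgs (cons Φ as) r (cons Φ' as')

data DSeq : ∀ {Γ t τ} → Deriv Γ t τ → ∀ {Γ' t' τ'} → Deriv Γ' t' τ' → Set where
  dDone : ∀ {Γ t τ} {Φ : Deriv Γ t τ} → DSeq Φ Φ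
  dCons : ∀ {Γ t τ Γ₁ t₁ τ₁ Γ₂ t₂ τ₂ r} {Φ : Deriv Γ t τ} {Φ₁ : Deriv Γ₁ t₁ τ₁}
            {Φ₂ : Deriv Γ₂ t₂ τ₂} →
          Step t r t₁ → DStep Φ r Φ₁ → DSeq Φ₁ Φ₂ → DSeq Φ Φ₂

LeftmostTyped : ∀ {Γ t τ} → Deriv Γ t τ → Pos → Set
LeftmostTyped Φ r = TypedRedex Φ r × (∀ r' → TypedRedex Φ r' → r' ≢ r → LeftOf r r')

-- (finite) leftmost typed reduction sequences starting at Φ
data LTSeq : ∀ {Γ t τ} → Deriv Γ t τ → Set where
  ltDone : ∀ {Γ t τ} {Φ : Deriv Γ t τ} → LTSeq Φ
  ltCons : ∀ {Γ t τ Γ₁ t₁ τ₁ r} {Φ : Deriv Γ t τ} {Φ₁ : Deriv Γ₁ t₁ τ₁} →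
           Step t r t₁ → DStep Φ r Φ₁ → LeftmostTyped Φ r → LTSeq Φ₁ → LTSeq Φ

AllStepsNeeded : ∀ {Γ t τ} {Φ : Deriv Γ t τ} → LTSeq Φ → Set
AllStepsNeeded ltDone = ⊤
AllStepsNeeded (ltCons {t = t} {r = r} _ _ _ rest) = WeakHeadNeeded t r × AllStepsNeeded rest

apps : Term → List Term → Term
apps = foldl app

arrows : ℕ → Type → Type
arrows zero τ = τ
arrows (suc n) τ = [] ⇒ arrows n τ

NormalPrincipal : ∀ {Γ t τ} → Deriv Γ t τ → Set
NormalPrincipal {Γ} {t} {τ} _ =
  (Σ ℕ λ x → Σ (List Term) λ ts → Σ ℕ λ α →
     t ≡ apps (var x) ts × τ ≡ tvar α × Γ ≈C single x (arrows (length ts) (tvar α) ∷ []))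
  ⊎ (Σ Term λ s → t ≡ lam s × Γ ≈C ∅ × τ ≡ tA)

PrincipallyTyped : ∀ {Γ t τ} → Deriv Γ t τ → Set
PrincipallyTyped Φ =
  ∀ {Γ' t' τ'} (Φ' : Deriv Γ' t' τ') → DSeq Φ Φ' → WHNF t' → NormalPrincipal Φ'

-- A principally typed derivation types exactly what weak-head reduction needs: once the
-- term reaches a weak-head normal form its derivation must be normal principal, and such a
-- derivation types no redex, since its context gives the head variable the type
-- [] → … → [] → α, leaving every argument untyped.  Hence, as long as a typed redex remains,
-- the term is not a WHNF and so has a head redex.  The head redex is always typed and no
-- redex lies to its left, so it is the leftmost typed redex; and it is weak-head needed,
-- because a step elsewhere leaves it in place as the head redex of the reduct.
module Submission where

open import Defs
open import Data.Bool using (true; false)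
open import Data.Empty using (⊥-elim)
open import Data.List using ([]; _∷_; _++_; length)
open import Data.List.Membership.Propositional using (_∈_)
open import Data.List.Membership.Propositional.Properties using (∈-++⁺ˡ; ∈-++⁺ʳ; ∈-++⁻)
open import Data.List.Properties using (++-conicalʳ; ≡-dec)
open import Data.List.Relation.Unary.Any using (here; there)
open import Data.Nat using (zero; suc; _≡ᵇ_)
open import Data.Nat.Properties using (≡⇒≡ᵇ)
open import Data.Product using (∃; ∃₂; _×_; _,_)
open import Data.Sum using (_⊎_; inj₁; inj₂; [_,_])
open import Data.Unit using (tt)
open import Function using (_∘_)
open import Relation.Binary.Definitions using (DecidableEquality)
open import Relation.Binary.PropositionalEquality using (_≡_; _≢_; refl; sym; subst₂)
open import Relation.Nullary using (¬_; yes; no)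
open import Relation.Nullary.Decidable using (decidable-stable)

single-self : ∀ x M → single x M x ≡ M
single-self x M with x ≡ᵇ x | ≡⇒≡ᵇ x x refl
... | true  | _ = refl
... | false | ()

∈-single : ∀ x y {σ τ} → σ ∈ single x (τ ∷ []) y → σ ≡ τ
∈-single x y m with y ≡ᵇ x
∈-single x y (here σ≡τ) | true = σ≡τ

∷≈M⇒≢[] : ∀ {σ M N} → (σ ∷ M) ≈M N → N ≢ []
∷≈M⇒≢[] (∷≈ {N₁ = N₁} _ _) N≡[] with () ← ++-conicalʳ N₁ _ N≡[]

∈-insert : ∀ {A : Set} {v y : A} xs {ys} → v ∈ xs ++ ys → v ∈ xs ++ (y ∷ ys)
∈-insert xs = [ ∈-++⁺ˡ , ∈-++⁺ʳ xs ∘ there ] ∘ ∈-++⁻ xs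

∈-resp-≈M : ∀ {σ A B} → σ ∈ A → A ≈M B → ∃ λ σ' → σ' ∈ B × σ ≈T σ'
∈-resp-≈M (here refl) (∷≈ {N₁ = N₁} σ≈σ' _) = _ , ∈-++⁺ʳ N₁ (here refl) , σ≈σ'
∈-resp-≈M (there m) (∷≈ {N₁ = N₁} _ A≈B) with ∈-resp-≈M m A≈B
... | σ' , m' , σ≈σ' = σ' , ∈-insert N₁ m' , σ≈σ'

data Demanding : Type → Set where
  dom : ∀ {σ M τ} → Demanding ((σ ∷ M) ⇒ τ)
  cod : ∀ {M τ} → Demanding τ → Demanding (M ⇒ τ)

¬Demanding-arrows : ∀ n {τ α} → Demanding τ → ¬ τ ≈T arrows n (tvar α)
¬Demanding-arrows zero    dom     ()
¬Demanding-arrows zero    (cod _) ()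
¬Demanding-arrows (suc n) dom     (⇒≈ M≈[] _) = ∷≈M⇒≢[] M≈[] refl
¬Demanding-arrows (suc n) (cod d) (⇒≈ _ τ≈)   = ¬Demanding-arrows n d τ≈

typedArg⇒Demanding : ∀ {Δ u M N τ p} {as : Args Δ u N} →
                     TOccArgs as p → M ≈M N → Demanding (M ⇒ τ)
typedArg⇒Demanding {M = _ ∷ _} _ _ = dom
typedArg⇒Demanding {M = []} (hd _) ()
typedArg⇒Demanding {M = []} (tl _) ()

DemandingCtx : Ctx → Set
DemandingCtx Γ = ∃₂ λ x τ → τ ∈ Γ x × Demanding τ

DemandingCtx-⊕ˡ : ∀ {Γ} Δ → DemandingCtx Γ → DemandingCtx (Γ ⊕ Δ)
DemandingCtx-⊕ˡ Δ (x , τ , m , d) = x , τ , ∈-++⁺ˡ m , d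

normalPrincipal⇒¬DemandingCtx : ∀ {Γ t τ} {Φ : Deriv Γ t τ} →
                                NormalPrincipal Φ → ¬ DemandingCtx Γ
normalPrincipal⇒¬DemandingCtx (inj₁ (x , ts , _ , _ , _ , Γ≈)) (y , τ , m , d)
  with ∈-resp-≈M m (Γ≈ y)
... | τ' , m' , τ≈τ' with refl ← ∈-single x y m' = ¬Demanding-arrows (length ts) d τ≈τ'
normalPrincipal⇒¬DemandingCtx (inj₂ (_ , _ , Γ≈∅ , _)) (y , τ , m , d)
  with ∈-resp-≈M m (Γ≈∅ y)
... | _ , () , _

neutral-Demanding : ∀ {Γ t τ} → Neutral t → Deriv Γ t τ → Demanding τ → DemandingCtx Γ
neutral-Demanding nvar (ax {x} {τ}) d = x , τ , subst₂ _∈_ refl (sym (single-self x _)) (here refl) , d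
neutral-Demanding (napp n) (appE {Δ = Δ} Φ _ _) d = DemandingCtx-⊕ˡ Δ (neutral-Demanding n Φ (cod d))

neutral-TypedRedex : ∀ {Γ t τ p} → Neutral t → (Φ : Deriv Γ t τ) → TypedRedex Φ p → DemandingCtx Γ
neutral-TypedRedex nvar ax ((_ , _ , ()) , root)
neutral-TypedRedex (napp ()) (appE _ _ _) ((_ , _ , refl) , root)
neutral-TypedRedex (napp n) (appE {Δ = Δ} Φ _ _) (red , inFun o) =
  DemandingCtx-⊕ˡ Δ (neutral-TypedRedex n Φ (red , o))
neutral-TypedRedex (napp n) (appE {Δ = Δ} Φ _ M≈N) (_ , inArg o) =
  DemandingCtx-⊕ˡ Δ (neutral-Demanding n Φ (typedArg⇒Demanding o M≈N))

appsNeutral : ∀ {t} ts → Neutral t → Neutral (apps t ts)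
appsNeutral []       n = n
appsNeutral (u ∷ ts) n = appsNeutral ts (napp n)

lam≢neutral : ∀ {s t} → Neutral t → lam s ≢ t
lam≢neutral n refl with () ← n

normalPrincipal⇒Normal : ∀ {Γ t τ} {Φ : Deriv Γ t τ} → WHNF t → NormalPrincipal Φ → Normal Φ
normalPrincipal⇒Normal {Φ = Φ} (wneu n) np p red o =
  normalPrincipal⇒¬DemandingCtx {Φ = Φ} np (neutral-TypedRedex n Φ (red , o))
normalPrincipal⇒Normal wlam (inj₁ (_ , ts , _ , lam≡apps , _)) _ _ _
  with () ← lam≢neutral (appsNeutral ts nvar) lam≡apps
normalPrincipal⇒Normal {Φ = val} wlam (inj₂ _) _ (_ , _ , ()) root
normalPrincipal⇒Normal {Φ = lamI _} wlam (inj₂ (_ , _ , _ , ())) _ _ _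

data HeadRedex : Term → Pos → Set where
  head : ∀ {s u} → HeadRedex (app (lam s) u) []
  fun  : ∀ {t u h} → HeadRedex t h → HeadRedex (app t u) (d0 ∷ h)

whnf⊎headRedex : ∀ t → WHNF t ⊎ ∃ (HeadRedex t)
whnf⊎headRedex (var x) = inj₁ (wneu nvar)
whnf⊎headRedex (lam s) = inj₁ wlam
whnf⊎headRedex (app t u) with whnf⊎headRedex t
... | inj₁ wlam     = inj₂ (_ , head)
... | inj₁ (wneu n) = inj₁ (wneu (napp n))
... | inj₂ (h , hr) = inj₂ (_ , fun hr)

headRedex-Redex : ∀ {t h} → HeadRedex t h → Redex t h
headRedex-Redex head     = _ , _ , refl
headRedex-Redex (fun hr) = headRedex-Redex hr

headRedex-TOcc : ∀ {Γ t τ h} → HeadRedex t h → (Φ : Deriv Γ t τ) → TOcc Φ h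
headRedex-TOcc head     _            = root
headRedex-TOcc (fun hr) (appE Φ _ _) = inFun (headRedex-TOcc hr Φ)

headRedex-¬WHNF : ∀ {t h} → HeadRedex t h → ¬ WHNF t
headRedex-¬WHNF head     (wneu (napp ()))
headRedex-¬WHNF (fun hr) (wneu (napp n)) = headRedex-¬WHNF hr (wneu n)

headRedex-¬LeftOf : ∀ {t h r} → HeadRedex t h → Redex t r → ¬ LeftOf r h
headRedex-¬LeftOf {r = r} head _ (inj₁ (w , w≢[] , []≡r++w)) = w≢[] (++-conicalʳ r w (sym []≡r++w))
headRedex-¬LeftOf head _ (inj₂ (p , _ , q' , _ , []≡p++d1q'))
  with () ← ++-conicalʳ p (d1 ∷ q') (sym []≡p++d1q')
headRedex-¬LeftOf {r = []} (fun ()) (_ , _ , refl) _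
headRedex-¬LeftOf {r = d0 ∷ r} (fun hr) red (inj₁ (w , w≢[] , refl)) =
  headRedex-¬LeftOf hr red (inj₁ (w , w≢[] , refl))
headRedex-¬LeftOf {r = d1 ∷ r} (fun hr) _ (inj₁ (_ , _ , ()))
headRedex-¬LeftOf (fun hr) _ (inj₂ ([] , _ , _ , _ , ()))
headRedex-¬LeftOf (fun hr) _ (inj₂ (d1 ∷ p , _ , _ , _ , ()))
headRedex-¬LeftOf (fun hr) red (inj₂ (d0 ∷ p , q , q' , refl , refl)) =
  headRedex-¬LeftOf hr red (inj₂ (p , q , q' , refl , refl))

headRedex-Step : ∀ {t h p t₁} → HeadRedex t h → Step t p t₁ →
                 p ≡ h ⊎ (HeadRedex t₁ h × ¬ Prefix p h)
headRedex-Step head β               = inj₁ refl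
headRedex-Step head (appL (lamS _)) = inj₂ (head , λ ())
headRedex-Step head (appR _)        = inj₂ (head , λ ())
headRedex-Step (fun ()) β
headRedex-Step (fun hr) (appR _)    = inj₂ (fun hr , λ ())
headRedex-Step (fun hr) (appL st) with headRedex-Step hr st
... | inj₁ refl         = inj₁ refl
... | inj₂ (hr' , ¬p≤h) = inj₂ (fun hr' , λ { (w , refl) → ¬p≤h (w , refl) })

headRedex-WeakHeadNeeded : ∀ {t h} → HeadRedex t h → WeakHeadNeeded t h
headRedex-WeakHeadNeeded hr done w = ⊥-elim (headRedex-¬WHNF hr w)
headRedex-WeakHeadNeeded hr (cons p st σ) w with headRedex-Step hr st
... | inj₁ refl         = now
... | inj₂ (hr' , ¬p≤h) = later (resDisj ¬p≤h) (headRedex-WeakHeadNeeded hr' σ w)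

_≟ᴰ_ : DecidableEquality Dir
d0 ≟ᴰ d0 = yes refl
d0 ≟ᴰ d1 = no λ ()
d1 ≟ᴰ d0 = no λ ()
d1 ≟ᴰ d1 = yes refl

leftmostTyped-headRedex : ∀ {Γ t τ r h} {Φ : Deriv Γ t τ} →
                          LeftmostTyped Φ r → HeadRedex t h → r ≡ h
leftmostTyped-headRedex {r = r} {h} {Φ} ((red , _) , leftmost) hr =
  decidable-stable (≡-dec _≟ᴰ_ r h) λ r≢h →
    headRedex-¬LeftOf hr red (leftmost h (headRedex-Redex hr , headRedex-TOcc hr Φ) (r≢h ∘ sym))

leftmostTyped-WeakHeadNeeded : ∀ {Γ t τ r} {Φ : Deriv Γ t τ} →
                               PrincipallyTyped Φ → LeftmostTyped Φ r → WeakHeadNeeded t r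
leftmostTyped-WeakHeadNeeded {t = t} {Φ = Φ} pt lm@((red , o) , _) with whnf⊎headRedex t
... | inj₁ w = ⊥-elim (normalPrincipal⇒Normal w (pt Φ dDone w) _ red o)
... | inj₂ (h , hr) with refl ← leftmostTyped-headRedex lm hr = headRedex-WeakHeadNeeded hr

principallyTyped-step : ∀ {Γ t τ Γ₁ t₁ τ₁ r} {Φ : Deriv Γ t τ} {Φ₁ : Deriv Γ₁ t₁ τ₁} →
                        Step t r t₁ → DStep Φ r Φ₁ → PrincipallyTyped Φ → PrincipallyTyped Φ₁
principallyTyped-step st ds pt Φ' ds' = pt Φ' (dCons st ds ds')

principallyTyped⇒AllStepsNeeded : ∀ {Γ t τ} {Φ : Deriv Γ t τ} →
                                   PrincipallyTyped Φ → (σ : LTSeq Φ) → AllStepsNeeded σ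
principallyTyped⇒AllStepsNeeded pt ltDone              = tt
principallyTyped⇒AllStepsNeeded pt (ltCons st ds lm σ) =
  leftmostTyped-WeakHeadNeeded pt lm ,
  principallyTyped⇒AllStepsNeeded (principallyTyped-step st ds pt) σ

-- The weak-head normalisation hypothesis only keeps principal typability from being
-- vacuous; the argument itself does not use it.
mainTheorem13 : ∀ {Γ t τ} (Φ : Deriv Γ t τ) → WHNormalising t → PrincipallyTyped Φ →
                (σ : LTSeq Φ) → AllStepsNeeded σ
mainTheorem13 _ _ = principallyTyped⇒AllStepsNeeded
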